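{- Let $n\geq 1$, nonnegative integers $a_0,\ldots,a_n$, $a:=\sum a_k$, $I=\{i_1<\cdots<i_m\}\subseteq\{0,\ldots,n\}$ and a multiset $J=\{j_1\leq\cdots\leq j_m\}$ of elements of $\{0,\ldots,n\}\setminus I$ be given. Let $2\leq h\leq m$ and $U=\{i_h,i_{h+1},\ldots,i_m\}$. Then $$q^{C(U)+L^*(U\mid U)}-q^{C(U\cup\{i_{h-1}\})+L^*(U\mid U\cup\{i_{h-1}\})}=0.$$
   Context: For a (multi)set $S$, $N(k,S)$ is the number of elements of $S$ (with multiplicity) that are $\leq k$. For a nonempty $I'\subseteq I$ its pairing multiset is $J'=\{j_s: i_s\in I'\}$. For nonempty $T\subseteq I'$: let $p=\min I'$, let $J'^-$ (resp. $J'^+$) be the elements of $J'$ less than $p$ (resp. greater than $p$), $t'=|J'^-|$, and $w_k=a_k$ for $k\notin T$, $w_k=0$ for $k\in T$; then $L^*(T\mid I')=t'+\sum_{k=p}^{n}[N(k,I')-N(k,J'^+)]w_k+\sum_{k=0}^{p-1}[t'-N(k,J'^-)]a_k$. For nonempty $I'\subseteq I$ with $|I'|=l$, write $I\setminus I'=\{i_{r_1},\ldots,i_{r_{m-l}}\}$ with $r_1<\cdots<r_{m-l}$, set $\mathbb{I}_{m-l+1}=I'$, $\mathbb{I}_k=\mathbb{I}_{k+1}\cup\{i_{r_k}\}$ for $k=m-l,\ldots,1$, and let $J_k^*$ be the multiset of elements of $J'\cup\{j_{r_k}\}$ strictly greater than $\min\mathbb{I}_k$. Then $C(I')=1+a-\sum_{k\in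 I'}a_k+\sum_{k=1}^{m-l}[N(i_{r_k},I')-N(i_{r_k},J_k^*)]a_{i_{r_k}}-L^*(I'\mid I')$. -}

module Defs where

open import Data.Bool using (Bool; true; false; if_then_else_; not)
open import Data.Nat using (ℕ; zero; suc; _+_; _∸_; _≤ᵇ_; _<ᵇ_; _≡ᵇ_; _⊓_)
open import Data.List using (List; []; _∷_; map; filterᵇ; length; upTo; foldr; _++_)
open import Data.Bool.ListAction using (any)
open import Data.Integer using (ℤ; +_; _-_; _*_) renaming (_+_ to _+ℤ_)

-- Conventions: I = {i 1 < ... < i m}, J = {j 1 ≤ ... ≤ j m} given as sequences
-- ℕ → ℕ (only indices 1..m matter); the pairing is i s ↦ j s.
-- A nonempty subset I' ⊆ I is given by the mask sel on indices 1..m.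

idx : ℕ → List ℕ
idx m = map suc (upTo m)

N : ℕ → List ℕ → ℕ
N k S = length (filterᵇ (λ x → x ≤ᵇ k) S)

-- minimum of a list (only used on nonempty lists)
minL : List ℕ → ℕ
minL [] = 0
minL (x ∷ xs) = foldr _⊓_ x xs

sumFromTo : (ℕ → ℤ) → ℕ → ℕ → ℤ
sumFromTo f p n = foldr _+ℤ_ (+ 0) (map (λ k → f (p + k)) (upTo (suc n ∸ p)))

sumBelow : (ℕ → ℤ) → ℕ → ℤ
sumBelow f p = foldr _+ℤ_ (+ 0) (map f (upTo p))

Ivals : (m : ℕ) → (i : ℕ → ℕ) → (ℕ → Bool) → List ℕ
Ivals m i sel = map i (filterᵇ sel (idx m))

Jvals : (m : ℕ) → (j : ℕ → ℕ) → (ℕ → Bool) → List ℕ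
Jvals m j sel = map j (filterᵇ sel (idx m))

-- L*(T | I'), T a list of values (a subset of I'), I' given by sel
Lstar : (n : ℕ) → (a : ℕ → ℕ) → (m : ℕ) → (i j : ℕ → ℕ) →
        List ℕ → (ℕ → Bool) → ℤ
Lstar n a m i j T sel =
  (+ t') +ℤ sumFromTo (λ k → ((+ N k I') - (+ N k Jp)) * (+ w k)) p n
         +ℤ sumBelow (λ k → ((+ t') - (+ N k Jm)) * (+ a k)) p
  where
  I' = Ivals m i sel
  J' = Jvals m j sel
  p  = minL I'
  Jm = filterᵇ (λ x → x <ᵇ p) J'
  Jp = filterᵇ (λ x → p <ᵇ x) J'
  t' = length Jm
  w : ℕ → ℕ
  w k = if any (λ x → x ≡ᵇ k) T then 0 else a k

-- Σ_{k=1}^{m-l} [N(i_{r_k}, I') - N(i_{r_k}, J_k^*)] a_{i_{r_k}},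
-- computed by recursion over the suffixes (r_k, r_{k+1}, ..., r_{m-l}) of
-- the increasing list of indices not in I'; 𝕀_k = I' ∪ {i_{r_k},...,i_{r_{m-l}}}.
Csum : (a : ℕ → ℕ) → (i j : ℕ → ℕ) → (I' J' : List ℕ) → List ℕ → ℤ
Csum a i j I' J' [] = + 0
Csum a i j I' J' (r ∷ rs) =
  ((+ N (i r) I') - (+ N (i r) Jstar)) * (+ a (i r)) +ℤ Csum a i j I' J' rs
  where
  𝕀 = I' ++ map i (r ∷ rs)
  Jstar = filterᵇ (λ x → minL 𝕀 <ᵇ x) (J' ++ (j r ∷ []))

atot : (n : ℕ) → (a : ℕ → ℕ) → ℕ
atot n a = foldr _+_ 0 (map a (upTo (suc n)))

C : (n : ℕ) → (a : ℕ → ℕ) → (m : ℕ) → (i j : ℕ → ℕ) → (ℕ → Bool) → ℤ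
C n a m i j sel =
  (+ (1 + atot n a)) - (+ foldr _+_ 0 (map a I'))
    +ℤ Csum a i j I' J' rs
    - Lstar n a m i j I' sel
  where
  I' = Ivals m i sel
  J' = Jvals m j sel
  rs = filterᵇ (λ s → not (sel s)) (idx m)

module Submission where

-- Both exponents equal 1 + a − Σ_{k∈U} a_k. The correction sums in C(U) and
-- C(U ∪ {i_{h−1}}) vanish: every index outside the chosen set lies below all of
-- its members, so both counts N(i_{r_k}, ·) are 0. Adding i_{h−1} raises Σ a_k by
-- a_{i_{h−1}}, and L*(U | U ∪ {i_{h−1}}) exceeds L*(U ∪ {i_{h−1}} | U ∪ {i_{h−1}})
-- by exactly a_{i_{h−1}}: the two differ only in the weight at the pivot
-- p = i_{h−1}, whose coefficient N(p, I') − N(p, J'⁺) is 1.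

open import Defs
open import Data.Nat using (ℕ; _≤_; _<_; _∸_; _≤ᵇ_)
open import Data.Integer using (ℤ) renaming (_+_ to _+ℤ_)
open import Relation.Binary.PropositionalEquality using (_≡_; _≢_)

open import Data.Bool using (Bool; not; if_then_else_; T)
open import Data.Bool.Properties using (T-not-≡)
open import Data.Bool.ListAction using (any)
open import Data.Nat using (zero; suc; _+_; _<ᵇ_; _≡ᵇ_; _⊓_; _≤?_; _≟_; z≤n; s≤s)
import Data.Nat.Properties as ℕ
open import Data.Integer using (+_; _-_; _*_)
import Data.Integer.Properties as ℤ
open import Data.Integer.Solver using (module +-*-Solver)
open import Data.List using (List; []; _∷_; _++_; map; filterᵇ; length; foldr; upTo; applyUpTo)
open import Data.List.Properties
  using (filter-++; filter-all; filter-none; filter-accept; map-applyUpTo; map-cong; map-∘; ++-identityʳ)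
open import Data.List.Relation.Unary.All as All using (All; []; _∷_)
open import Data.List.Relation.Unary.All.Properties using (all-filter; map⁺; ++⁺)
open import Data.List.Relation.Unary.AllPairs using (AllPairs; []; _∷_)
open import Function using (_∘_)
open import Function.Bundles using (Equivalence)
open import Relation.Nullary using (¬_)
open import Relation.Nullary.Decidable using (T?; dec-true; dec-false)
open import Relation.Binary.PropositionalEquality using (refl; sym; trans; cong; cong₂; subst; module ≡-Reasoning)

open +-*-Solver using (solve; _:+_; _:-_; _:=_; con)

interval : ℕ → ℕ → List ℕ
interval b zero    = []
interval b (suc k) = b ∷ interval (suc b) k

applyUpTo-interval : ∀ (f : ℕ → ℕ) b k → (∀ x → f x ≡ x + b) → applyUpTo f k ≡ interval b k
applyUpTo-interval f b zero    f≗ = refl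
applyUpTo-interval f b (suc k) f≗ =
  cong₂ _∷_ (f≗ 0) (applyUpTo-interval (f ∘ suc) (suc b) k (λ x → trans (f≗ (suc x)) (sym (ℕ.+-suc x b))))

idx≡interval : ∀ m → idx m ≡ interval 1 m
idx≡interval m = trans (map-applyUpTo (λ x → x) suc m) (applyUpTo-interval suc 1 m (λ x → ℕ.+-comm 1 x))

interval-++ : ∀ b k l → interval b (k + l) ≡ interval b k ++ interval (b + k) l
interval-++ b zero    l = cong (λ c → interval c l) (sym (ℕ.+-identityʳ b))
interval-++ b (suc k) l =
  cong (b ∷_) (trans (interval-++ (suc b) k l) (cong (λ c → interval (suc b) k ++ interval c l) (sym (ℕ.+-suc b k))))

<-+-suc : ∀ {b k y} → y < suc b + k → y < b + suc k
<-+-suc {b} {k} y< = ℕ.≤-trans y< (ℕ.≤-reflexive (sym (ℕ.+-suc b k)))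

All-interval : ∀ {P : ℕ → Set} b k → (∀ x → b ≤ x → x < b + k → P x) → All P (interval b k)
All-interval b zero    P-on = []
All-interval b (suc k) P-on =
  P-on b ℕ.≤-refl (ℕ.m<m+n b (s≤s z≤n)) ∷
  All-interval (suc b) k (λ x b<x x< → P-on x (ℕ.<⇒≤ b<x) (<-+-suc x<))

AllPairs-interval : ∀ {R : ℕ → ℕ → Set} b k → (∀ x y → b ≤ x → x < y → y < b + k → R x y) →
                    AllPairs R (interval b k)
AllPairs-interval b zero    R-on = []
AllPairs-interval b (suc k) R-on =
  All-interval (suc b) k (λ y b<y y< → R-on b y ℕ.≤-refl b<y (<-+-suc y<)) ∷
  AllPairs-interval (suc b) k (λ x y b<x x<y y< → R-on x y (ℕ.<⇒≤ b<x) x<y (<-+-suc y<))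

idx-split : ∀ {m k} → k ≤ m → idx m ≡ interval 1 k ++ interval (suc k) (m ∸ k)
idx-split {m} {k} k≤m = begin
  idx m                                    ≡⟨ idx≡interval m ⟩
  interval 1 m                             ≡⟨ cong (interval 1) (sym (ℕ.m+[n∸m]≡n k≤m)) ⟩
  interval 1 (k + (m ∸ k))                 ≡⟨ interval-++ 1 k (m ∸ k) ⟩
  interval 1 k ++ interval (suc k) (m ∸ k) ∎
  where open ≡-Reasoning

-- filterᵇ p is filter (T? ∘ p), so the lemmas about filter apply.
filterᵇ-≥-++ : ∀ k xs ys → All (_≤ k) xs → All (k <_) ys → filterᵇ (suc k ≤ᵇ_) (xs ++ ys) ≡ ys
filterᵇ-≥-++ k xs ys xs≤k k<ys = begin
  filterᵇ (suc k ≤ᵇ_) (xs ++ ys)                          ≡⟨ filter-++ P? xs ys ⟩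
  filterᵇ (suc k ≤ᵇ_) xs ++ filterᵇ (suc k ≤ᵇ_) ys        ≡⟨ cong₂ _++_ (filter-none P? (All.map reject xs≤k)) (filter-all P? (All.map ℕ.≤⇒≤ᵇ k<ys)) ⟩
  ys                                                      ∎
  where
  open ≡-Reasoning
  P? = λ x → T? (suc k ≤ᵇ x)
  reject : ∀ {x} → x ≤ k → ¬ T (suc k ≤ᵇ x)
  reject x≤k t = ℕ.≤⇒≯ x≤k (ℕ.≤ᵇ⇒≤ (suc k) _ t)

filterᵇ-<-++ : ∀ k xs ys → All (_≤ k) xs → All (k <_) ys → filterᵇ (λ s → not (suc k ≤ᵇ s)) (xs ++ ys) ≡ xs
filterᵇ-<-++ k xs ys xs≤k k<ys = begin
  filterᵇ p (xs ++ ys)                ≡⟨ filter-++ P? xs ys ⟩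
  filterᵇ p xs ++ filterᵇ p ys        ≡⟨ cong₂ _++_ (filter-all P? (All.map accept xs≤k)) (filter-none P? (All.map reject k<ys)) ⟩
  xs ++ []                            ≡⟨ ++-identityʳ xs ⟩
  xs                                  ∎
  where
  open ≡-Reasoning
  p = λ s → not (suc k ≤ᵇ s)
  P? = λ x → T? (p x)
  accept : ∀ {x} → x ≤ k → T (p x)
  accept x≤k = Equivalence.from T-not-≡ (dec-false (suc k ≤? _) (ℕ.≤⇒≯ x≤k))
  reject : ∀ {y} → k < y → ¬ T (p y)
  reject {y} k<y = subst (T ∘ not) (dec-true (suc k ≤? y) k<y)

interval-≤ : ∀ k → All (_≤ k) (interval 1 k)
interval-≤ k = All-interval 1 k (λ x _ x<1+k → ℕ.≤-pred x<1+k)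

interval-> : ∀ k l → All (k <_) (interval (suc k) l)
interval-> k l = All-interval (suc k) l (λ x k<x _ → k<x)

module _ {m k : ℕ} (k≤m : k ≤ m) where

  Ivals-above : ∀ i → Ivals m i (suc k ≤ᵇ_) ≡ map i (interval (suc k) (m ∸ k))
  Ivals-above i = trans (cong (λ xs → map i (filterᵇ (suc k ≤ᵇ_) xs)) (idx-split k≤m))
                        (cong (map i) (filterᵇ-≥-++ k _ _ (interval-≤ k) (interval-> k (m ∸ k))))

  indices-below : filterᵇ (λ s → not (suc k ≤ᵇ s)) (idx m) ≡ interval 1 k
  indices-below = trans (cong (filterᵇ (λ s → not (suc k ≤ᵇ s))) (idx-split k≤m))
                        (filterᵇ-<-++ k _ _ (interval-≤ k) (interval-> k (m ∸ k)))

Ivals-step : ∀ {m k} i → suc k ≤ m → Ivals m i (suc k ≤ᵇ_) ≡ i (suc k) ∷ Ivals m i (suc (suc k) ≤ᵇ_)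
Ivals-step {m} {k} i k<m = begin
  Ivals m i (suc k ≤ᵇ_)                               ≡⟨ Ivals-above (ℕ.<⇒≤ k<m) i ⟩
  map i (interval (suc k) (suc m ∸ suc k))            ≡⟨ cong (map i ∘ interval (suc k)) (ℕ.+-∸-assoc 1 k<m) ⟩
  i (suc k) ∷ map i (interval (suc (suc k)) (m ∸ suc k)) ≡⟨ cong (i (suc k) ∷_) (sym (Ivals-above k<m i)) ⟩
  i (suc k) ∷ Ivals m i (suc (suc k) ≤ᵇ_)             ∎
  where open ≡-Reasoning

N-above : ∀ {k} xs → All (k <_) xs → N k xs ≡ 0
N-above {k} xs k<xs = cong length (filter-none (λ x → T? (x ≤ᵇ k)) (All.map reject k<xs))
  where
  reject : ∀ {x} → k < x → ¬ T (x ≤ᵇ k)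
  reject k<x t = ℕ.<⇒≱ k<x (ℕ.≤ᵇ⇒≤ _ k t)

N-filter-above : ∀ {k b} xs → k ≤ b → N k (filterᵇ (b <ᵇ_) xs) ≡ 0
N-filter-above {k} {b} xs k≤b =
  N-above (filterᵇ (b <ᵇ_) xs) (All.map (λ t → ℕ.≤-<-trans k≤b (ℕ.<ᵇ⇒< b _ t)) (all-filter (λ x → T? (b <ᵇ x)) xs))

N-head : ∀ {k} xs → All (k <_) xs → N k (k ∷ xs) ≡ 1
N-head {k} xs k<xs = begin
  length (filterᵇ (_≤ᵇ k) (k ∷ xs))    ≡⟨ cong length (filter-accept (λ x → T? (x ≤ᵇ k)) {k} {xs} (ℕ.≤⇒≤ᵇ (ℕ.≤-refl {k}))) ⟩
  suc (N k xs)                         ≡⟨ cong suc (N-above xs k<xs) ⟩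
  1                                    ∎
  where open ≡-Reasoning

≤-foldr-⊓ : ∀ {b} x xs → b ≤ x → All (b ≤_) xs → b ≤ foldr _⊓_ x xs
≤-foldr-⊓ x []       b≤x []           = b≤x
≤-foldr-⊓ x (y ∷ ys) b≤x (b≤y ∷ b≤ys) = ℕ.⊓-glb b≤y (≤-foldr-⊓ x ys b≤x b≤ys)

≤-minL-++ : ∀ {b} xs y ys → All (b ≤_) (xs ++ y ∷ ys) → b ≤ minL (xs ++ y ∷ ys)
≤-minL-++ []       y ys (b≤y ∷ b≤ys) = ≤-foldr-⊓ y ys b≤y b≤ys
≤-minL-++ (x ∷ xs) y ys (b≤x ∷ b≤xs) = ≤-foldr-⊓ x (xs ++ y ∷ ys) b≤x b≤xs

minL-head : ∀ x xs → All (x ≤_) xs → minL (x ∷ xs) ≡ x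
minL-head x []       []           = refl
minL-head x (y ∷ ys) (x≤y ∷ x≤ys) = trans (cong (y ⊓_) (minL-head x ys x≤ys)) (ℕ.m≥n⇒m⊓n≡n x≤y)

module _ (a : ℕ → ℕ) (i j : ℕ → ℕ) where

  Csum-zero : ∀ I' J' rs → All (λ r → All (i r <_) I') rs → AllPairs (λ r s → i r ≤ i s) rs →
              Csum a i j I' J' rs ≡ + 0
  Csum-zero I' J' []       []             []                  = refl
  Csum-zero I' J' (r ∷ rs) (r<I' ∷ rs<I') (r≤rs ∷ rs-sorted) =
    cong₂ _+ℤ_ (cong₂ (λ u v → ((+ u) - (+ v)) * (+ a (i r))) (N-above I' r<I') (N-filter-above (J' ++ j r ∷ []) r≤min))
               (Csum-zero I' J' rs rs<I' rs-sorted)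
    where
    r≤min : i r ≤ minL (I' ++ map i (r ∷ rs))
    r≤min = ≤-minL-++ I' (i r) (map i rs) (++⁺ (All.map ℕ.<⇒≤ r<I') (ℕ.≤-refl ∷ map⁺ r≤rs))

module _ {m : ℕ} {i : ℕ → ℕ} (i-mono : ∀ s t → 1 ≤ s → s < t → t ≤ m → i s < i t) where

  Csum-threshold : ∀ a j {k} J' → k ≤ m →
    Csum a i j (Ivals m i (suc k ≤ᵇ_)) J' (filterᵇ (λ s → not (suc k ≤ᵇ s)) (idx m)) ≡ + 0
  Csum-threshold a j {k} J' k≤m =
    trans (cong₂ (λ I' rs → Csum a i j I' J' rs) (Ivals-above k≤m i) (indices-below k≤m))
          (Csum-zero a i j _ J' (interval 1 k) below<above below-sorted)
    where
    below<above : All (λ r → All (i r <_) (map i (interval (suc k) (m ∸ k)))) (interval 1 k)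
    below<above = All-interval 1 k λ r 1≤r r<1+k → map⁺ (All-interval (suc k) (m ∸ k) λ t k<t t<1+m →
      i-mono r t 1≤r (ℕ.≤-<-trans (ℕ.≤-pred r<1+k) k<t) (ℕ.≤-trans (ℕ.≤-pred t<1+m) (ℕ.≤-reflexive (ℕ.m+[n∸m]≡n k≤m))))
    below-sorted : AllPairs (λ r s → i r ≤ i s) (interval 1 k)
    below-sorted = AllPairs-interval 1 k λ r s 1≤r r<s s<1+k →
      ℕ.<⇒≤ (i-mono r s 1≤r r<s (ℕ.≤-trans (ℕ.≤-pred s<1+k) k≤m))

  Ivals-step-head< : ∀ {k} → suc k ≤ m → All (i (suc k) <_) (Ivals m i (suc (suc k) ≤ᵇ_))
  Ivals-step-head< {k} k<m = subst (All (i (suc k) <_)) (sym (Ivals-above k<m i))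
    (map⁺ (All-interval (suc (suc k)) (m ∸ suc k) λ t k<t t<1+m →
      i-mono (suc k) t (s≤s z≤n) k<t (ℕ.≤-trans (ℕ.≤-pred t<1+m) (ℕ.≤-reflexive (ℕ.m+[n∸m]≡n k<m)))))

-- The weight w of the definition of Lstar.
weight : (ℕ → ℕ) → List ℕ → ℕ → ℕ
weight a T k = if any (λ x → x ≡ᵇ k) T then 0 else a k

weight-∉ : ∀ a {k} T → All (_≢ k) T → weight a T k ≡ a k
weight-∉ a []      []           = refl
weight-∉ a {k} (x ∷ T) (x≢k ∷ T∌k) rewrite dec-false (x ≟ k) x≢k = weight-∉ a T T∌k

weight-cons : ∀ a {k y} T → y ≢ k → weight a (y ∷ T) k ≡ weight a T k
weight-cons a {k} {y} T y≢k rewrite dec-false (y ≟ k) y≢k = refl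

weight-head : ∀ a {k} T → weight a (k ∷ T) k ≡ 0
weight-head a {k} T rewrite dec-true (k ≟ k) refl = refl

sumFromTo-head : ∀ f {p n} → p ≤ n → sumFromTo f p n ≡ f p +ℤ sumFromTo f (suc p) n
sumFromTo-head f {p} {n} p≤n rewrite ℕ.+-∸-assoc 1 p≤n =
  cong₂ _+ℤ_ (cong f (ℕ.+-identityʳ p)) (cong (foldr _+ℤ_ (+ 0)) (begin
    map g (applyUpTo suc (n ∸ p))           ≡⟨ cong (map g) (sym (map-applyUpTo (λ x → x) suc (n ∸ p))) ⟩
    map g (map suc (upTo (n ∸ p)))          ≡⟨ sym (map-∘ (upTo (n ∸ p))) ⟩
    map (g ∘ suc) (upTo (n ∸ p))            ≡⟨ map-cong (λ k → cong f (ℕ.+-suc p k)) (upTo (n ∸ p)) ⟩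
    map (λ k → f (suc p + k)) (upTo (n ∸ p)) ∎))
  where
  open ≡-Reasoning
  g = λ k → f (p + k)

sumFromTo-cong : ∀ {f g} p n → (∀ k → p ≤ k → f k ≡ g k) → sumFromTo f p n ≡ sumFromTo g p n
sumFromTo-cong p n f≗g = cong (foldr _+ℤ_ (+ 0)) (map-cong (λ k → f≗g (p + k) (ℕ.m≤m+n p k)) (upTo (suc n ∸ p)))

module _ (n : ℕ) (a : ℕ → ℕ) (m : ℕ) (i j : ℕ → ℕ) (sel : ℕ → Bool) where

  -- The local definitions of Lstar, so that Lstar T sel unfolds to + t' +ℤ sumFromTo (F T) p n +ℤ B.
  private
    I' = Ivals m i sel
    p  = minL I'
    t' = length (filterᵇ (_<ᵇ p) (Jvals m j sel))
    B  = sumBelow (λ k → ((+ t') - (+ N k (filterᵇ (_<ᵇ p) (Jvals m j sel)))) * (+ a k)) p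
    coef : ℕ → ℤ
    coef k = (+ N k I') - (+ N k (filterᵇ (p <ᵇ_) (Jvals m j sel)))
    F : List ℕ → ℕ → ℤ
    F T k = coef k * (+ weight a T k)

  Lstar-cons-pivot : ∀ {T} → p ≤ n → N p I' ≡ 1 → All (p <_) T →
                     Lstar n a m i j T sel ≡ Lstar n a m i j (p ∷ T) sel +ℤ + a p
  Lstar-cons-pivot {T} p≤n N≡1 p<T = begin
    + t' +ℤ sumFromTo (F T) p n +ℤ B
      ≡⟨ cong (λ s → + t' +ℤ s +ℤ B) (sumFromTo-head (F T) p≤n) ⟩
    + t' +ℤ (F T p +ℤ S T) +ℤ B
      ≡⟨ cong₂ (λ x s → + t' +ℤ (x +ℤ s) +ℤ B) F-T-p (sumFromTo-cong (suc p) n above) ⟩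
    + t' +ℤ (+ a p +ℤ S (p ∷ T)) +ℤ B
      ≡⟨ solve 4 (λ t A s b → t :+ (A :+ s) :+ b := t :+ (con (+ 0) :+ s) :+ b :+ A) refl (+ t') (+ a p) (S (p ∷ T)) B ⟩
    + t' +ℤ (+ 0 +ℤ S (p ∷ T)) +ℤ B +ℤ + a p
      ≡⟨ cong (λ x → + t' +ℤ (x +ℤ S (p ∷ T)) +ℤ B +ℤ + a p) (sym F-pT-p) ⟩
    + t' +ℤ (F (p ∷ T) p +ℤ S (p ∷ T)) +ℤ B +ℤ + a p
      ≡⟨ cong (λ s → + t' +ℤ s +ℤ B +ℤ + a p) (sym (sumFromTo-head (F (p ∷ T)) p≤n)) ⟩
    + t' +ℤ sumFromTo (F (p ∷ T)) p n +ℤ B +ℤ + a p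
      ∎
    where
    open ≡-Reasoning
    S : List ℕ → ℤ
    S T = sumFromTo (F T) (suc p) n
    coef-p : coef p ≡ + 1
    coef-p = cong₂ (λ u v → (+ u) - (+ v)) N≡1 (N-filter-above (Jvals m j sel) ℕ.≤-refl)
    F-T-p : F T p ≡ + a p
    F-T-p = trans (cong₂ _*_ coef-p (cong +_ (weight-∉ a T (All.map ℕ.>⇒≢ p<T)))) (ℤ.*-identityˡ (+ a p))
    F-pT-p : F (p ∷ T) p ≡ + 0
    F-pT-p = cong₂ _*_ coef-p (cong +_ (weight-head a T))
    above : ∀ k → suc p ≤ k → F T k ≡ F (p ∷ T) k
    above k p<k = cong (λ w → coef k * (+ w)) (sym (weight-cons a T (ℕ.<⇒≢ p<k)))

  Lstar-drop-min : ∀ {q T} → I' ≡ q ∷ T → All (q <_) T → q ≤ n →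
                   Lstar n a m i j T sel ≡ Lstar n a m i j I' sel +ℤ + a q
  Lstar-drop-min {q} {T} I'≡ q<T q≤n = begin
    Lstar n a m i j T sel                 ≡⟨ Lstar-cons-pivot (subst (_≤ n) (sym p≡q) q≤n) N≡1 (subst (λ x → All (x <_) T) (sym p≡q) q<T) ⟩
    Lstar n a m i j (p ∷ T) sel +ℤ + a p  ≡⟨ cong (λ x → Lstar n a m i j (x ∷ T) sel +ℤ + a x) p≡q ⟩
    Lstar n a m i j (q ∷ T) sel +ℤ + a q  ≡⟨ cong (λ T' → Lstar n a m i j T' sel +ℤ + a q) (sym I'≡) ⟩
    Lstar n a m i j I' sel +ℤ + a q       ∎
    where
    open ≡-Reasoning
    p≡q : p ≡ q
    p≡q = trans (cong minL I'≡) (minL-head q T (All.map ℕ.<⇒≤ q<T))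
    N≡1 : N p I' ≡ 1
    N≡1 = trans (cong₂ N p≡q I'≡) (N-head T q<T)

-- The two sides of the theorem with C unfolded.
exponent-balance : ∀ K {s s′ A C₁ C₂ L₁ L₂ L₃} → C₁ ≡ + 0 → C₂ ≡ + 0 → s′ ≡ A + s → L₃ ≡ L₂ +ℤ + A →
                   K - (+ s) +ℤ C₁ - L₁ +ℤ L₁ ≡ K - (+ s′) +ℤ C₂ - L₂ +ℤ L₃
exponent-balance K {s} {A = A} {L₁ = L₁} {L₂} refl refl refl refl rewrite ℤ.pos-+ A s =
  solve 5 (λ K S A L₁ L₂ → K :- S :+ con (+ 0) :- L₁ :+ L₁ := K :- (A :+ S) :+ con (+ 0) :- L₂ :+ (L₂ :+ A))
    refl K (+ s) (+ A) L₁ L₂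

lemma4p5 : (n : ℕ) → 1 ≤ n → (a : ℕ → ℕ) → (m : ℕ) → (i j : ℕ → ℕ) →
    (∀ s → 1 ≤ s → s ≤ m → i s ≤ n) →
    (∀ s t → 1 ≤ s → s < t → t ≤ m → i s < i t) →
    (∀ s → 1 ≤ s → s ≤ m → j s ≤ n) →
    (∀ s t → 1 ≤ s → s ≤ t → t ≤ m → j s ≤ j t) →
    (∀ s t → 1 ≤ s → s ≤ m → 1 ≤ t → t ≤ m → j s ≢ i t) →
    (h : ℕ) → 2 ≤ h → h ≤ m →
    C n a m i j (λ s → h ≤ᵇ s) +ℤ Lstar n a m i j (Ivals m i (λ s → h ≤ᵇ s)) (λ s → h ≤ᵇ s)
      ≡ C n a m i j (λ s → (h ∸ 1) ≤ᵇ s) +ℤ Lstar n a m i j (Ivals m i (λ s → h ≤ᵇ s)) (λ s → (h ∸ 1) ≤ᵇ s)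
lemma4p5 n _ a m i j i≤n i-mono _ _ _ (suc (suc g)) (s≤s (s≤s z≤n)) h≤m =
  exponent-balance (+ (1 + atot n a))
    (Csum-threshold i-mono a j _ ℓ≤m)
    (Csum-threshold i-mono a j _ (ℕ.<⇒≤ ℓ≤m))
    (cong (foldr _+_ 0 ∘ map a) U-step)
    (Lstar-drop-min n a m i j (ℓ ≤ᵇ_) U-step (Ivals-step-head< i-mono ℓ≤m) (i≤n ℓ (s≤s z≤n) ℓ≤m))
  where
  ℓ = suc g
  ℓ≤m = ℕ.<⇒≤ h≤m
  U-step = Ivals-step i ℓ≤m
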